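{- Let ${\bf n}'=n'_1n'_2\cdots$ be the fixed point of $0\mapsto01$, $1\mapsto2$, $2\mapsto0$ starting with $0$, indexed from $1$. Let $p_1(j)$ be the position of the $j$-th occurrence of $1$ in ${\bf n}'$ and $p_{02}(j)$ the position of the $j$-th occurrence of a letter in $\{0,2\}$ in ${\bf n}'$. Let $(a(j))_{j\ge1}$ be the increasing enumeration of the positive integers $k$ whose Narayana representation $(k)_N$ ends in a $1$ followed by exactly $3s$ or $3s+2$ zeros for some $s\ge0$, and $(b(j))_{j\ge1}$ the increasing enumeration of the positive integers $k$ whose $(k)_N$ ends in a $1$ followed by exactly $3s+1$ zeros for some $s\ge0$. Then $a(j)=p_{02}(j)$ and $b(j)=p_1(j)$ for all $j\ge1$.
   Context: Narayana numbers: $N_0=1,N_1=2,N_2=3$, $N_i=N_{i-1}+N_{i-3}$ for $i\ge3$. The Narayana representation $(k)_N$ of a positive integer $k$ is the unique binary word $e_1\cdots e_t$ with $e_1=1$, no factor $11$ or $101$, and $k=\sum_{i=1}^te_iN_{t-i}$. -}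

module Defs where

open import Data.Nat using (ℕ; zero; suc; _+_; _*_; _≤_; _<_)
open import Data.Bool using (Bool; true; false)
open import Data.List using (List; []; _∷_; _++_; concatMap; replicate; length)
open import Data.Product using (Σ; _×_; ∃; ∃-syntax)
open import Data.Sum using (_⊎_)
open import Relation.Binary.PropositionalEquality using (_≡_)
open import Relation.Nullary using (¬_)
open import Function.Bundles using (_⇔_)

N : ℕ → ℕ
N 0 = 1
N 1 = 2
N 2 = 3
N (suc (suc (suc i))) = N (suc (suc i)) + N i

bit : Bool → ℕ
bit true  = 1
bit false = 0

value : List Bool → ℕ
value []       = 0
value (e ∷ es) = bit e * N (length es) + value es

-- w has no factor 11 and no factor 101
data Admissible : List Bool → Set where
  adm-[]  : Admissible []
  adm-0   : ∀ {w} → Admissible w → Admissible (false ∷ w)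
  adm-1   : Admissible (true ∷ [])
  adm-10  : Admissible (true ∷ false ∷ [])
  adm-100 : ∀ {w} → Admissible (false ∷ w) → Admissible (true ∷ false ∷ false ∷ w)

IsNarRep : ℕ → List Bool → Set
IsNarRep k w = Σ (List Bool) (λ u → w ≡ true ∷ u) × Admissible w × value w ≡ k

EndsWith1Then0s : ℕ → ℕ → Set
EndsWith1Then0s k m =
  1 ≤ k × ∃[ w ] (IsNarRep k w × ∃[ u ] (w ≡ u ++ (true ∷ replicate m false)))

SetA : ℕ → Set
SetA k = ∃[ s ] (EndsWith1Then0s k (3 * s) ⊎ EndsWith1Then0s k (3 * s + 2))

SetB : ℕ → Set
SetB k = ∃[ s ] EndsWith1Then0s k (3 * s + 1)

σ : ℕ → List ℕ
σ 0 = 0 ∷ 1 ∷ []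
σ 1 = 2 ∷ []
σ 2 = 0 ∷ []
σ _ = []

iterσ : ℕ → List ℕ
iterσ zero    = 0 ∷ []
iterσ (suc m) = concatMap σ (iterσ m)

lookupD : List ℕ → ℕ → ℕ
lookupD []       _       = 0
lookupD (x ∷ xs) zero    = x
lookupD (x ∷ xs) (suc i) = lookupD xs i

-- n'_i for i ≥ 1 (indexed from 1): σ^i(0) is a prefix of the fixed point of
-- length ≥ i+1, so its (i-1)-th letter (0-indexed) is n'_i.
n' : ℕ → ℕ
n' zero    = 0  -- unused junk value (sequence indexed from 1)
n' (suc i) = lookupD (iterσ (suc i)) i

Pos1 : ℕ → Set
Pos1 i = 1 ≤ i × n' i ≡ 1

Pos02 : ℕ → Set
Pos02 i = 1 ≤ i × (n' i ≡ 0 ⊎ n' i ≡ 2)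

IsIncEnum : (ℕ → Set) → (ℕ → ℕ) → Set
IsIncEnum S a =
  (∀ i j → 1 ≤ i → i < j → a i < a j) ×
  (∀ j → 1 ≤ j → S (a j)) ×
  (∀ k → S k → ∃[ j ] (1 ≤ j × a j ≡ k))

-- The iterates W t = σ^t(0) satisfy W (t+3) = W (t+2) W t, so |W t| = N t, each W t is a prefix
-- of the next, and the last letter of W t is t mod 3. If (k)_N = e₁⋯e_t, the length-k prefix
-- of n' is the concatenation of the blocks W (t - i) over the positions i with e_i = 1, so its
-- last letter n'_k is the last letter of the final block W m, where m is the number of
-- trailing zeros of (k)_N. Hence A and B are exactly the sets of positions of the letters 0, 2
-- and of the letter 1, and increasing enumerations of the same set agree.
module Submission where

open import Defs
open import Data.Nat using (ℕ; zero; suc; _+_; _*_; _∸_; _≤_; _<_; z≤n; s≤s; _<?_)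
open import Data.Nat.Properties
open import Data.Nat.DivMod using (_%_; _/_; m≡m%n+[m/n]*n; [m+kn]%n≡m%n)
open import Data.Nat.Induction using (<-rec)
open import Data.Bool using (Bool; true; false)
open import Data.List using (List; []; _∷_; _++_; concatMap; replicate; length)
open import Data.List.Properties using (length-++; ++-assoc; ++-identityʳ; concatMap-++; length-replicate)
open import Data.Product using (_×_; _,_; ∃; ∃-syntax; proj₁)
open import Data.Sum using (_⊎_; inj₁; inj₂)
open import Data.Empty using (⊥-elim)
open import Function.Bundles using (_⇔_; mk⇔; Equivalence)
open import Relation.Binary.Definitions using (tri<; tri≈; tri>)
open import Relation.Nullary using (¬_; yes; no)
open import Relation.Binary.PropositionalEquality
open ≡-Reasoning

N-positive : ∀ t → 1 ≤ N t
N-positive 0 = s≤s z≤n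
N-positive 1 = s≤s z≤n
N-positive 2 = s≤s z≤n
N-positive (suc (suc (suc t))) = ≤-trans (N-positive (suc (suc t))) (m≤m+n _ _)

N-mono-suc : ∀ t → N t ≤ N (suc t)
N-mono-suc 0 = s≤s z≤n
N-mono-suc 1 = s≤s (s≤s z≤n)
N-mono-suc (suc (suc t)) = m≤m+n _ _

n<N : ∀ t → t < N t
n<N 0 = s≤s z≤n
n<N 1 = s≤s (s≤s z≤n)
n<N 2 = s≤s (s≤s (s≤s z≤n))
n<N (suc (suc (suc t))) =
  subst (_≤ N (suc (suc t)) + N t) (+-comm (3 + t) 1) (+-mono-≤ (n<N (suc (suc t))) (N-positive t))

N∸1<N : ∀ t → N t ∸ 1 < N t
N∸1<N t = ∸-monoʳ-< (s≤s z≤n) (N-positive t)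

[3s+j]%3≡j%3 : ∀ s j → (3 * s + j) % 3 ≡ j % 3
[3s+j]%3≡j%3 s j = trans (cong (_% 3) (trans (+-comm (3 * s) j) (cong (j +_) (*-comm 3 s))))
                         ([m+kn]%n≡m%n j s 3)

m%3≡j⇒m≡3[m/3]+j : ∀ {m j} → m % 3 ≡ j → m ≡ 3 * (m / 3) + j
m%3≡j⇒m≡3[m/3]+j {m} refl =
  trans (m≡m%n+[m/n]*n m 3) (trans (+-comm (m % 3) _) (cong (_+ m % 3) (*-comm (m / 3) 3)))

lookupD-++ˡ : ∀ xs ys {i} → i < length xs → lookupD (xs ++ ys) i ≡ lookupD xs i
lookupD-++ˡ (x ∷ xs) ys {zero}  _         = refl
lookupD-++ˡ (x ∷ xs) ys {suc i} (s≤s i<n) = lookupD-++ˡ xs ys i<n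

lookupD-++ʳ : ∀ xs ys i → lookupD (xs ++ ys) (length xs + i) ≡ lookupD ys i
lookupD-++ʳ []       ys i = refl
lookupD-++ʳ (x ∷ xs) ys i = lookupD-++ʳ xs ys i

iterσ-recurrence : ∀ t → iterσ (3 + t) ≡ iterσ (2 + t) ++ iterσ t
iterσ-recurrence zero    = refl
iterσ-recurrence (suc t) =
  trans (cong (concatMap σ) (iterσ-recurrence t)) (concatMap-++ σ (iterσ (2 + t)) (iterσ t))

length-iterσ : ∀ t → length (iterσ t) ≡ N t
length-iterσ 0 = refl
length-iterσ 1 = refl
length-iterσ 2 = refl
length-iterσ (suc (suc (suc t))) = begin
  length (iterσ (3 + t))                  ≡⟨ cong length (iterσ-recurrence t) ⟩
  length (iterσ (2 + t) ++ iterσ t)       ≡⟨ length-++ (iterσ (2 + t)) ⟩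
  length (iterσ (2 + t)) + length (iterσ t)
    ≡⟨ cong₂ _+_ (length-iterσ (suc (suc t))) (length-iterσ t) ⟩
  N (2 + t) + N t                         ∎

iterσ-extends : ∀ t → ∃[ v ] iterσ (suc t) ≡ iterσ t ++ v
iterσ-extends 0             = 1 ∷ [] , refl
iterσ-extends 1             = 2 ∷ [] , refl
iterσ-extends (suc (suc t)) = iterσ t , iterσ-recurrence t

iterσ-prefix : ∀ d t → ∃[ v ] iterσ (d + t) ≡ iterσ t ++ v
iterσ-prefix zero    t = [] , sym (++-identityʳ (iterσ t))
iterσ-prefix (suc d) t with iterσ-prefix d t | iterσ-extends (d + t)
... | v , d+t≡t++v | v' , e = v ++ v' , (begin
  iterσ (suc d + t)          ≡⟨ e ⟩
  iterσ (d + t) ++ v'        ≡⟨ cong (_++ v') d+t≡t++v ⟩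
  (iterσ t ++ v) ++ v'       ≡⟨ ++-assoc (iterσ t) v v' ⟩
  iterσ t ++ (v ++ v')       ∎)

lookupD-iterσ-prefix : ∀ {t t' i} → t ≤ t' → i < N t →
                       lookupD (iterσ t') i ≡ lookupD (iterσ t) i
lookupD-iterσ-prefix {t} {t'} {i} t≤t' i<N with d , refl ← m≤n⇒∃[o]m+o≡n t≤t'
  with v , e ← iterσ-prefix d t = begin
  lookupD (iterσ (t + d)) i       ≡⟨ cong (λ s → lookupD (iterσ s) i) (+-comm t d) ⟩
  lookupD (iterσ (d + t)) i       ≡⟨ cong (λ w → lookupD w i) e ⟩
  lookupD (iterσ t ++ v) i
    ≡⟨ lookupD-++ˡ (iterσ t) v (subst (i <_) (sym (length-iterσ t)) i<N) ⟩
  lookupD (iterσ t) i             ∎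

lookupD-iterσ-shift : ∀ t i → lookupD (iterσ (3 + t)) (N (2 + t) + i) ≡ lookupD (iterσ t) i
lookupD-iterσ-shift t i = begin
  lookupD (iterσ (3 + t)) (N (2 + t) + i)
    ≡⟨ cong₂ lookupD (iterσ-recurrence t) (cong (_+ i) (sym (length-iterσ (2 + t)))) ⟩
  lookupD (iterσ (2 + t) ++ iterσ t) (length (iterσ (2 + t)) + i)
    ≡⟨ lookupD-++ʳ (iterσ (2 + t)) (iterσ t) i ⟩
  lookupD (iterσ t) i
    ∎

lookupD-iterσ-last : ∀ t → lookupD (iterσ t) (N t ∸ 1) ≡ t % 3
lookupD-iterσ-last 0 = refl
lookupD-iterσ-last 1 = refl
lookupD-iterσ-last 2 = refl
lookupD-iterσ-last (suc (suc (suc t))) = begin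
  lookupD (iterσ (3 + t)) (N (2 + t) + N t ∸ 1)
    ≡⟨ cong (lookupD (iterσ (3 + t))) (+-∸-assoc (N (2 + t)) (N-positive t)) ⟩
  lookupD (iterσ (3 + t)) (N (2 + t) + (N t ∸ 1)) ≡⟨ lookupD-iterσ-shift t (N t ∸ 1) ⟩
  lookupD (iterσ t) (N t ∸ 1)                     ≡⟨ lookupD-iterσ-last t ⟩
  t % 3                                           ≡⟨ [3s+j]%3≡j%3 1 t ⟨
  (3 + t) % 3                                     ∎

n'-lookupD : ∀ t {i} → i < N t → n' (suc i) ≡ lookupD (iterσ t) i
n'-lookupD t {i} i<N with ≤-total (suc i) t
... | inj₁ 1+i≤t = sym (lookupD-iterσ-prefix 1+i≤t (<-trans (n<1+n i) (n<N (suc i))))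
... | inj₂ t≤1+i = lookupD-iterσ-prefix t≤1+i i<N

value-true : ∀ w → value (true ∷ w) ≡ N (length w) + value w
value-true w = cong (_+ value w) (*-identityˡ (N (length w)))

value-replicate : ∀ m → value (replicate m false) ≡ 0
value-replicate zero    = refl
value-replicate (suc m) = value-replicate m

value<N : ∀ {w} → Admissible w → value w < N (length w)
value<N adm-[]           = s≤s z≤n
value<N (adm-0 {w} a)    = <-≤-trans (value<N a) (N-mono-suc (length w))
value<N adm-1            = s≤s (s≤s z≤n)
value<N adm-10           = s≤s (s≤s (s≤s z≤n))
value<N (adm-100 {w} (adm-0 a)) = subst (_< N (3 + length w)) (sym (value-true (false ∷ false ∷ w)))
  (+-monoʳ-< (N (2 + length w)) (value<N a))

data Ends1Then0s (m : ℕ) : List Bool → Set where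
  here  : Ends1Then0s m (true ∷ replicate m false)
  there : ∀ {b w} → Ends1Then0s m w → Ends1Then0s m (b ∷ w)

Ends1Then0s-++ : ∀ {m} u → Ends1Then0s m (u ++ true ∷ replicate m false)
Ends1Then0s-++ []      = here
Ends1Then0s-++ (_ ∷ u) = there (Ends1Then0s-++ u)

Ends1Then0s⇒++ : ∀ {m w} → Ends1Then0s m w → ∃[ u ] w ≡ u ++ true ∷ replicate m false
Ends1Then0s⇒++ here = [] , refl
Ends1Then0s⇒++ (there {b} e) with u , refl ← Ends1Then0s⇒++ e = b ∷ u , refl

value-positive : ∀ {m w} → Ends1Then0s m w → 1 ≤ value w
value-positive {m} here = subst (1 ≤_) (sym (value-true (replicate m false)))
  (≤-trans (N-positive (length (replicate m false))) (m≤m+n _ _))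
value-positive (there {b} {w} e) = ≤-trans (value-positive e) (m≤n+m (value w) (bit b * N (length w)))

letter-at-value : ∀ {m w} → Admissible w → Ends1Then0s m w →
                  lookupD (iterσ (length w)) (value w ∸ 1) ≡ m % 3
letter-at-value (adm-0 {w} a) (there e) =
  trans (lookupD-iterσ-prefix (n≤1+n (length w)) (≤-<-trans (m∸n≤m (value w) 1) (value<N a)))
        (letter-at-value a e)
letter-at-value {zero}  adm-1 here = refl
letter-at-value {suc _} adm-1 (there ())
letter-at-value {suc zero} adm-10 here = refl
letter-at-value adm-10 (there (there ()))
letter-at-value {suc (suc m)} (adm-100 (adm-0 _)) here = begin
  lookupD (iterσ (3 + L)) (value w ∸ 1)
    ≡⟨ cong (λ n → lookupD (iterσ (3 + L)) (n ∸ 1)) value≡N ⟩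
  lookupD (iterσ (3 + L)) (N (2 + L) ∸ 1)
    ≡⟨ lookupD-iterσ-prefix (n≤1+n (2 + L)) (N∸1<N (2 + L)) ⟩
  lookupD (iterσ (2 + L)) (N (2 + L) ∸ 1)   ≡⟨ lookupD-iterσ-last (2 + L) ⟩
  (2 + L) % 3                               ≡⟨ cong (λ n → (2 + n) % 3) (length-replicate m) ⟩
  (2 + m) % 3                               ∎
  where
  L = length (replicate m false)
  w = true ∷ replicate (2 + m) false
  value≡N : value w ≡ N (2 + L)
  value≡N = trans (value-true (replicate (2 + m) false))
                  (trans (cong (N (2 + L) +_) (value-replicate m)) (+-identityʳ _))
letter-at-value {m} (adm-100 (adm-0 {w} a)) (there (there (there e))) = begin
  lookupD (iterσ (3 + L)) (value (true ∷ false ∷ false ∷ w) ∸ 1)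
    ≡⟨ cong (λ n → lookupD (iterσ (3 + L)) (n ∸ 1)) (value-true (false ∷ false ∷ w)) ⟩
  lookupD (iterσ (3 + L)) (N (2 + L) + value w ∸ 1)
    ≡⟨ cong (lookupD (iterσ (3 + L))) (+-∸-assoc (N (2 + L)) (value-positive e)) ⟩
  lookupD (iterσ (3 + L)) (N (2 + L) + (value w ∸ 1))
    ≡⟨ lookupD-iterσ-shift L (value w ∸ 1) ⟩
  lookupD (iterσ L) (value w ∸ 1)
    ≡⟨ letter-at-value a e ⟩
  m % 3
    ∎
  where L = length w

AllRepresentable : ℕ → Set
AllRepresentable t = ∀ k → k < N t → ∃[ w ] (Admissible w × length w ≡ t × value w ≡ k)

representable-step : ∀ t → AllRepresentable (2 + t) → AllRepresentable t → AllRepresentable (3 + t)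
representable-step t rep₂ rep₀ k k<N with k <? N (2 + t)
... | yes k<N' with w , a , len≡ , v ← rep₂ k k<N' = false ∷ w , adm-0 a , cong suc len≡ , v
... | no k≮N' with o , refl ← m≤n⇒∃[o]m+o≡n (≮⇒≥ k≮N')
  with w , a , refl , v ← rep₀ o (+-cancelˡ-< (N (2 + t)) o (N t) k<N) =
  true ∷ false ∷ false ∷ w , adm-100 (adm-0 a) , refl ,
  trans (value-true (false ∷ false ∷ w)) (cong (N (2 + length w) +_) v)

all-representable : ∀ t → AllRepresentable t
all-representable 0 0 _ = [] , adm-[] , refl , refl
all-representable 0 (suc _) (s≤s ())
all-representable 1 0 _ = false ∷ [] , adm-0 adm-[] , refl , refl
all-representable 1 1 _ = true ∷ [] , adm-1 , refl , refl
all-representable 1 (suc (suc _)) (s≤s (s≤s ()))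
all-representable 2 0 _ = false ∷ false ∷ [] , adm-0 (adm-0 adm-[]) , refl , refl
all-representable 2 1 _ = false ∷ true ∷ [] , adm-0 adm-1 , refl , refl
all-representable 2 2 _ = true ∷ false ∷ [] , adm-10 , refl , refl
all-representable 2 (suc (suc (suc _))) (s≤s (s≤s (s≤s ())))
all-representable (suc (suc (suc t))) =
  representable-step t (all-representable (suc (suc t))) (all-representable t)

drop-leading-0s : ∀ {w} → Admissible w → 1 ≤ value w →
                  ∃[ u ] (Admissible (true ∷ u) × value (true ∷ u) ≡ value w)
drop-leading-0s (adm-0 a)       1≤v = drop-leading-0s a 1≤v
drop-leading-0s adm-1           _   = [] , adm-1 , refl
drop-leading-0s adm-10          _   = false ∷ [] , adm-10 , refl
drop-leading-0s (adm-100 {w} a) _   = false ∷ false ∷ w , adm-100 a , refl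

0s⊎Ends1Then0s : ∀ w → (∃[ m ] w ≡ replicate m false) ⊎ (∃[ m ] Ends1Then0s m w)
0s⊎Ends1Then0s [] = inj₁ (0 , refl)
0s⊎Ends1Then0s (b ∷ w) with 0s⊎Ends1Then0s w
0s⊎Ends1Then0s (true  ∷ w) | inj₁ (m , refl) = inj₂ (m , here)
0s⊎Ends1Then0s (false ∷ w) | inj₁ (m , refl) = inj₁ (suc m , refl)
0s⊎Ends1Then0s (b     ∷ w) | inj₂ (m , e)    = inj₂ (m , there e)

Ends1Then0s-true∷ : ∀ u → ∃[ m ] Ends1Then0s m (true ∷ u)
Ends1Then0s-true∷ u with 0s⊎Ends1Then0s u
... | inj₁ (m , refl) = m , here
... | inj₂ (m , e)    = m , there e

narayana-representation : ∀ {k} → 1 ≤ k → ∃[ m ] EndsWith1Then0s k m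
narayana-representation {k} 1≤k with w , a , _ , refl ← all-representable k k (n<N k)
  with u , a' , v ← drop-leading-0s a 1≤k
  with m , e ← Ends1Then0s-true∷ u =
  m , 1≤k , true ∷ u , ((u , refl) , a' , v) , Ends1Then0s⇒++ e

n'≡trailing-0s%3 : ∀ {k m} → EndsWith1Then0s k m → n' k ≡ m % 3
n'≡trailing-0s%3 {suc i} {m} (_ , w , (_ , a , v) , u , refl) = begin
  n' (suc i)                              ≡⟨ n'-lookupD (length w) i<N ⟩
  lookupD (iterσ (length w)) i            ≡⟨ cong (λ n → lookupD (iterσ (length w)) (n ∸ 1)) v ⟨
  lookupD (iterσ (length w)) (value w ∸ 1) ≡⟨ letter-at-value a (Ends1Then0s-++ u) ⟩
  m % 3                                   ∎
  where
  i<N : i < N (length w)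
  i<N = <⇒≤ (subst (_< N (length w)) v (value<N a))

EndsWith1Then0s-mod3 : ∀ {k m j} → EndsWith1Then0s k m → n' k ≡ j →
                       EndsWith1Then0s k (3 * (m / 3) + j)
EndsWith1Then0s-mod3 {k} ew n'k≡j =
  subst (EndsWith1Then0s k) (m%3≡j⇒m≡3[m/3]+j (trans (sym (n'≡trailing-0s%3 ew)) n'k≡j)) ew

setA⇔pos02 : ∀ k → SetA k ⇔ Pos02 k
setA⇔pos02 k = mk⇔ to from
  where
  to : SetA k → Pos02 k
  to (s , inj₁ ew) = proj₁ ew , inj₁ (begin
    n' k               ≡⟨ n'≡trailing-0s%3 ew ⟩
    (3 * s) % 3        ≡⟨ cong (_% 3) (+-identityʳ (3 * s)) ⟨
    (3 * s + 0) % 3    ≡⟨ [3s+j]%3≡j%3 s 0 ⟩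
    0                  ∎)
  to (s , inj₂ ew) = proj₁ ew , inj₂ (trans (n'≡trailing-0s%3 ew) ([3s+j]%3≡j%3 s 2))
  from : Pos02 k → SetA k
  from (1≤k , n'k) with m , ew ← narayana-representation 1≤k | n'k
  ... | inj₁ n'k≡0 =
    m / 3 , inj₁ (subst (EndsWith1Then0s k) (+-identityʳ _) (EndsWith1Then0s-mod3 ew n'k≡0))
  ... | inj₂ n'k≡2 = m / 3 , inj₂ (EndsWith1Then0s-mod3 ew n'k≡2)

setB⇔pos1 : ∀ k → SetB k ⇔ Pos1 k
setB⇔pos1 k = mk⇔ to from
  where
  to : SetB k → Pos1 k
  to (s , ew) = proj₁ ew , trans (n'≡trailing-0s%3 ew) ([3s+j]%3≡j%3 s 1)
  from : Pos1 k → SetB k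
  from (1≤k , n'k≡1) with m , ew ← narayana-representation 1≤k =
    m / 3 , EndsWith1Then0s-mod3 ew n'k≡1

IsIncEnum-resp : ∀ {P Q : ℕ → Set} {a} → (∀ k → P k ⇔ Q k) → IsIncEnum P a → IsIncEnum Q a
IsIncEnum-resp P⇔Q (a-inc , a-mem , a-surj) =
  a-inc , (λ j 1≤j → to (P⇔Q _) (a-mem j 1≤j)) , (λ k qk → a-surj k (from (P⇔Q k) qk))
  where open Equivalence

IsIncEnum-not-below : ∀ {P a b} → IsIncEnum P a → IsIncEnum P b → ∀ j → 1 ≤ j →
                      (∀ {i} → i < j → 1 ≤ i → a i ≡ b i) → ¬ (a j < b j)
IsIncEnum-not-below (a-inc , a-mem , _) (b-inc , _ , b-surj) j 1≤j a≡b aj<bj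
  with i , 1≤i , bi≡aj ← b-surj _ (a-mem j 1≤j) | <-cmp i j
... | tri< i<j _ _ = <-irrefl (trans (a≡b i<j 1≤i) bi≡aj) (a-inc i j 1≤i i<j)
... | tri≈ _ refl _ = <-irrefl (sym bi≡aj) aj<bj
... | tri> _ _ j<i = <-irrefl (sym bi≡aj) (<-trans aj<bj (b-inc j i 1≤j j<i))

IsIncEnum-unique : ∀ {P a b} → IsIncEnum P a → IsIncEnum P b → ∀ j → 1 ≤ j → a j ≡ b j
IsIncEnum-unique {P} {a} {b} enumA enumB = <-rec (λ j → 1 ≤ j → a j ≡ b j) agree
  where
  agree : ∀ j → (∀ {i} → i < j → 1 ≤ i → a i ≡ b i) → 1 ≤ j → a j ≡ b j
  agree j a≡b 1≤j with <-cmp (a j) (b j)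
  ... | tri< aj<bj _ _ = ⊥-elim (IsIncEnum-not-below enumA enumB j 1≤j a≡b aj<bj)
  ... | tri≈ _ aj≡bj _ = aj≡bj
  ... | tri> _ _ bj<aj =
    ⊥-elim (IsIncEnum-not-below enumB enumA j 1≤j (λ i<j 1≤i → sym (a≡b i<j 1≤i)) bj<aj)

corollary24 : ((a p02 : ℕ → ℕ) → IsIncEnum SetA a → IsIncEnum Pos02 p02 →
                 ∀ j → 1 ≤ j → a j ≡ p02 j)
              × ((b p1 : ℕ → ℕ) → IsIncEnum SetB b → IsIncEnum Pos1 p1 →
                 ∀ j → 1 ≤ j → b j ≡ p1 j)
corollary24 =
  (λ a p02 enumA enum02 → IsIncEnum-unique (IsIncEnum-resp setA⇔pos02 enumA) enum02) ,
  (λ b p1 enumB enum1 → IsIncEnum-unique (IsIncEnum-resp setB⇔pos1 enumB) enum1)
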